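{- Let $z,w_1,w_2\in\{a,b\}^\star$ and let $u$ be the longest common prefix of $w_1$ and $w_2$. Then exactly one of the first three cases below occurs, and the stated conclusions hold: (1) if $w_1=u\,a\,u_1$ and $w_2=u\,b\,u_2$ for some words $u_1,u_2$, then $m(\overline{w_1}\,a z b\,w_2)\ge m(\overline{w_1}\,b\overline{z}a\,w_2)$; (2) if $w_1=u\,b\,u_1$ and $w_2=u\,a\,u_2$, then $m(\overline{w_1}\,a z b\,w_2)< m(\overline{w_1}\,b\overline{z}a\,w_2)$; (3) if $w_1=u$ or $w_2=u$, then $m(\overline{w_1}\,a z b\,w_2)< m(\overline{w_1}\,b\overline{z}a\,w_2)$; (4) moreover, $m(\overline{w_1}\,a z b\,w_2)=m(\overline{w_1}\,b\overline{z}a\,w_2)$ if and only if $w_1=ua$ and $w_2=ub$.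
   Context: For a word $w$, $\overline{w}$ denotes its reversal. Let $A=\begin{pmatrix}1&1\\1&2\end{pmatrix}$, $B=\begin{pmatrix}2&1\\1&1\end{pmatrix}$, and for $w=x_1\cdots x_k\in\{a,b\}^\star$ let $M^w=M^{x_1}\cdots M^{x_k}$ with $M^a=A$, $M^b=B$ ($M^w=I$ for the empty word). The $m$-value is $m(w)=\begin{pmatrix}1&0\end{pmatrix}M^w\begin{pmatrix}0\\1\end{pmatrix}$, the top-right entry of $M^w$. -}

module Defs where

open import Data.Nat using (ℕ; _+_; _*_; _≤_)
open import Data.List using (List; []; _∷_; _++_; reverse; length)
open import Data.Product using (Σ; ∃; _×_; _,_)
open import Data.Sum using (_⊎_)
open import Relation.Nullary using (¬_)
open import Relation.Binary.PropositionalEquality using (_≡_)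

data Letter : Set where
  a b : Letter

Word : Set
Word = List Letter

record Mat2 : Set where
  constructor mat
  field
    e11 e12 e21 e22 : ℕ
open Mat2 public

_⊗_ : Mat2 → Mat2 → Mat2
mat p q r s ⊗ mat p′ q′ r′ s′ =
  mat (p * p′ + q * r′) (p * q′ + q * s′) (r * p′ + s * r′) (r * q′ + s * s′)

I₂ : Mat2
I₂ = mat 1 0 0 1

A B : Mat2
A = mat 1 1 1 2
B = mat 2 1 1 1

M : Letter → Mat2
M a = A
M b = B

Mw : Word → Mat2
Mw []       = I₂
Mw (x ∷ xs) = M x ⊗ Mw xs

-- m(w) = (1 0) M^w (0 1)ᵀ, the top-right entry of M^w.
m : Word → ℕ
m w = e12 (Mw w)

rev : Word → Word
rev = reverse

IsPrefix : Word → Word → Set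
IsPrefix u w = ∃ λ s → w ≡ u ++ s

IsLCP : Word → Word → Word → Set
IsLCP u w₁ w₂ =
  IsPrefix u w₁ × IsPrefix u w₂ ×
  (∀ v → IsPrefix v w₁ → IsPrefix v w₂ → length v ≤ length u)

Case1 Case2 Case3 : Word → Word → Word → Set
Case1 u w₁ w₂ = ∃ λ u₁ → ∃ λ u₂ → (w₁ ≡ u ++ a ∷ u₁) × (w₂ ≡ u ++ b ∷ u₂)
Case2 u w₁ w₂ = ∃ λ u₁ → ∃ λ u₂ → (w₁ ≡ u ++ b ∷ u₁) × (w₂ ≡ u ++ a ∷ u₂)
Case3 u w₁ w₂ = (w₁ ≡ u) ⊎ (w₂ ≡ u)

ExactlyOne : Set → Set → Set → Set
ExactlyOne P Q R = (P ⊎ Q ⊎ R) × ¬ (P × Q) × ¬ (P × R) × ¬ (Q × R)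

lhsWord rhsWord : Word → Word → Word → Word
lhsWord z w₁ w₂ = rev w₁ ++ a ∷ z ++ b ∷ w₂
rhsWord z w₁ w₂ = rev w₁ ++ b ∷ rev z ++ a ∷ w₂

{-# OPTIONS --safe #-}
-- Since A and B are symmetric, M^w̄ is the transpose of M^w, so with W₁ = M^w₁, Z = M^z and
-- W₂ = M^w₂ the two m-values are the (1,2) entries of W₁ᵀ (A Z B) W₂ and W₁ᵀ (B Zᵀ A) W₂.
-- A direct computation gives A Z B − B Zᵀ A = skew Z · (0 −1 ; 1 0) with the positive number
-- skew Z = Z₁₁ + 3 Z₂₁ + Z₂₂, so the difference of the two m-values is −skew Z times the
-- determinant of the matrix whose columns are the first column of W₁ and the second column
-- of W₂. Multiplying both W₁ and W₂ on the left by A or B leaves this determinant unchanged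
-- (det A = det B = 1), so it only depends on what is left of w₁ and w₂ after their longest
-- common prefix u, and its sign can be read off from the first letters following u.
module Submission where

open import Defs
open import Data.Nat using (_≤_; _<_; _≥_)
open import Data.List using (_∷_; []; _++_)
open import Data.Product using (∃; _×_)
open import Data.Sum using (_⊎_)
open import Function.Bundles using (_⇔_)
open import Relation.Binary.PropositionalEquality using (_≡_)

open import Data.Nat using (ℕ; _+_; _*_; NonZero; >-nonZero; z<s)
open import Data.Nat.Properties
open import Data.Nat.Tactic.RingSolver using (solve-∀)
open import Data.List using (List; reverse; length; [_])
open import Data.List.Properties
  using (++-assoc; ++-identityʳ; ++-identityʳ-unique; ++-cancelˡ; unfold-reverse; length-++; ∷-injectiveˡ)
open import Data.Product using (_,_)
open import Data.Sum using (inj₁; inj₂)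
open import Function.Bundles using (mk⇔)
open import Relation.Nullary using (¬_; contradiction)
open import Relation.Binary.PropositionalEquality using (_≢_; refl; sym; trans; cong; cong₂; subst; module ≡-Reasoning)

mat-cong : ∀ {p q r s p′ q′ r′ s′} → p ≡ p′ → q ≡ q′ → r ≡ r′ → s ≡ s′ →
           mat p q r s ≡ mat p′ q′ r′ s′
mat-cong refl refl refl refl = refl

infix 30 _ᵀ
_ᵀ : Mat2 → Mat2
(mat p q r s) ᵀ = mat p r q s

-- Each entry of (X ⊗ Y) ⊗ Z is an instance of this, with (p q) a row of X and (r s) a column of Z.
row-col-assoc : ∀ p q y₁ y₂ y₃ y₄ r s →
  (p * y₁ + q * y₃) * r + (p * y₂ + q * y₄) * s ≡ p * (y₁ * r + y₂ * s) + q * (y₃ * r + y₄ * s)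
row-col-assoc = solve-∀

⊗-assoc : ∀ X Y Z → (X ⊗ Y) ⊗ Z ≡ X ⊗ (Y ⊗ Z)
⊗-assoc (mat x₁ x₂ x₃ x₄) Y (mat z₁ z₂ z₃ z₄) =
  mat-cong (row-col-assoc x₁ x₂ y₁ y₂ y₃ y₄ z₁ z₃) (row-col-assoc x₁ x₂ y₁ y₂ y₃ y₄ z₂ z₄)
           (row-col-assoc x₃ x₄ y₁ y₂ y₃ y₄ z₁ z₃) (row-col-assoc x₃ x₄ y₁ y₂ y₃ y₄ z₂ z₄)
  where open Mat2 Y renaming (e11 to y₁; e12 to y₂; e21 to y₃; e22 to y₄)

⊗-identityˡ : ∀ X → I₂ ⊗ X ≡ X
⊗-identityˡ (mat x₁ x₂ x₃ x₄) =
  mat-cong (unit-row x₁ x₃) (unit-row x₂ x₄) (*-identityˡ x₃) (*-identityˡ x₄)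
  where
  unit-row : ∀ x y → 1 * x + 0 * y ≡ x
  unit-row x _ = trans (+-identityʳ (1 * x)) (*-identityˡ x)

ᵀ-⊗ : ∀ X Y → (X ⊗ Y) ᵀ ≡ Y ᵀ ⊗ X ᵀ
ᵀ-⊗ (mat x₁ x₂ x₃ x₄) (mat y₁ y₂ y₃ y₄) =
  mat-cong (swap x₁ y₁ x₂ y₃) (swap x₃ y₁ x₄ y₃) (swap x₁ y₂ x₂ y₄) (swap x₃ y₂ x₄ y₄)
  where
  swap : ∀ p q r s → p * q + r * s ≡ q * p + s * r
  swap p q r s = cong₂ _+_ (*-comm p q) (*-comm r s)

Mw-++ : ∀ xs ys → Mw (xs ++ ys) ≡ Mw xs ⊗ Mw ys
Mw-++ []       ys = sym (⊗-identityˡ (Mw ys))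
Mw-++ (x ∷ xs) ys = trans (cong (M x ⊗_) (Mw-++ xs ys)) (sym (⊗-assoc (M x) (Mw xs) (Mw ys)))

Mw-[x]≡Mxᵀ : ∀ x → Mw [ x ] ≡ M x ᵀ
Mw-[x]≡Mxᵀ a = refl
Mw-[x]≡Mxᵀ b = refl

Mw-reverse : ∀ w → Mw (reverse w) ≡ Mw w ᵀ
Mw-reverse []      = refl
Mw-reverse (x ∷ w) = begin
  Mw (reverse (x ∷ w))      ≡⟨ cong Mw (unfold-reverse x w) ⟩
  Mw (reverse w ++ [ x ])   ≡⟨ Mw-++ (reverse w) [ x ] ⟩
  Mw (reverse w) ⊗ Mw [ x ] ≡⟨ cong₂ _⊗_ (Mw-reverse w) (Mw-[x]≡Mxᵀ x) ⟩
  Mw w ᵀ ⊗ M x ᵀ            ≡⟨ sym (ᵀ-⊗ (M x) (Mw w)) ⟩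
  (M x ⊗ Mw w) ᵀ            ∎
  where open ≡-Reasoning

-- x ⊖ x′ ≋ y ⊖ y′ says x − x′ = y − y′ in ℤ.
infix 4 _⊖_≋_⊖_
record _⊖_≋_⊖_ (x x′ y y′ : ℕ) : Set where
  constructor balanced
  field balance : x + y′ ≡ x′ + y

module _ {x x′ y y′ : ℕ} where

  ≋-negate : x ⊖ x′ ≋ y ⊖ y′ → x′ ⊖ x ≋ y′ ⊖ y
  ≋-negate (balanced eq) = balanced (sym eq)

  ≋-*ˡ : ∀ c → x ⊖ x′ ≋ y ⊖ y′ → c * x ⊖ c * x′ ≋ c * y ⊖ c * y′
  ≋-*ˡ c (balanced eq) = balanced (begin
    c * x + c * y′  ≡⟨ *-distribˡ-+ c x y′ ⟨
    c * (x + y′)    ≡⟨ cong (c *_) eq ⟩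
    c * (x′ + y)    ≡⟨ *-distribˡ-+ c x′ y ⟩
    c * x′ + c * y  ∎)
    where open ≡-Reasoning

  ≋-trans : ∀ {v v′} → x ⊖ x′ ≋ y ⊖ y′ → y ⊖ y′ ≋ v ⊖ v′ → x ⊖ x′ ≋ v ⊖ v′
  ≋-trans {v} {v′} (balanced eq₁) (balanced eq₂) =
    balanced (+-cancelʳ-≡ (y + y′) (x + v′) (x′ + v) (begin
      x + v′ + (y + y′)   ≡⟨ rearrange x v′ y y′ ⟩
      (x + y′) + (y + v′) ≡⟨ cong₂ _+_ eq₁ eq₂ ⟩
      (x′ + y) + (y′ + v) ≡⟨ rearrange x′ v y′ y ⟨
      x′ + v + (y′ + y)   ≡⟨ cong (x′ + v +_) (+-comm y′ y) ⟩
      x′ + v + (y + y′)   ∎))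
    where
    open ≡-Reasoning
    rearrange : ∀ p q r s → p + q + (r + s) ≡ (p + s) + (r + q)
    rearrange = solve-∀

≋-gap : ∀ {x y} c {p q d} → x ⊖ y ≋ c * p ⊖ c * q → p ≡ q + d → x ≡ y + c * d
≋-gap {x} {y} c {p} {q} {d} (balanced eq) p≡q+d = +-cancelʳ-≡ (c * q) x (y + c * d) (begin
  x + c * q            ≡⟨ eq ⟩
  y + c * p            ≡⟨ cong (λ t → y + c * t) p≡q+d ⟩
  y + c * (q + d)      ≡⟨ rearrange y c q d ⟩
  y + c * d + c * q    ∎)
  where
  open ≡-Reasoning
  rearrange : ∀ y c q d → y + c * (q + d) ≡ y + c * d + c * q
  rearrange = solve-∀

-- det⁺ N K − det⁻ N K is the determinant of the matrix whose columns are the first column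
-- of N and the second column of K.
det⁺ det⁻ : Mat2 → Mat2 → ℕ
det⁺ N K = e11 N * e22 K
det⁻ N K = e21 N * e12 K

-- det A = det B = 1.
det-M⊗ : ∀ x N K → det⁻ (M x ⊗ N) (M x ⊗ K) ⊖ det⁺ (M x ⊗ N) (M x ⊗ K) ≋ det⁻ N K ⊖ det⁺ N K
det-M⊗ a (mat n₁ _ n₃ _) (mat _ k₂ _ k₄) = balanced (unfolded n₁ n₃ k₂ k₄)
  where
  unfolded : ∀ n₁ n₃ k₂ k₄ →
    (1 * n₁ + 2 * n₃) * (1 * k₂ + 1 * k₄) + n₁ * k₄
      ≡ (1 * n₁ + 1 * n₃) * (1 * k₂ + 2 * k₄) + n₃ * k₂
  unfolded = solve-∀
det-M⊗ b (mat n₁ _ n₃ _) (mat _ k₂ _ k₄) = balanced (unfolded n₁ n₃ k₂ k₄)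
  where
  unfolded : ∀ n₁ n₃ k₂ k₄ →
    (1 * n₁ + 1 * n₃) * (2 * k₂ + 1 * k₄) + n₁ * k₄
      ≡ (2 * n₁ + 1 * n₃) * (1 * k₂ + 1 * k₄) + n₃ * k₂
  unfolded = solve-∀

det-common-prefix : ∀ u s₁ s₂ →
  det⁻ (Mw (u ++ s₁)) (Mw (u ++ s₂)) ⊖ det⁺ (Mw (u ++ s₁)) (Mw (u ++ s₂))
    ≋ det⁻ (Mw s₁) (Mw s₂) ⊖ det⁺ (Mw s₁) (Mw s₂)
det-common-prefix []      s₁ s₂ = balanced (+-comm (det⁻ (Mw s₁) (Mw s₂)) (det⁺ (Mw s₁) (Mw s₂)))
det-common-prefix (x ∷ u) s₁ s₂ =
  ≋-trans (det-M⊗ x (Mw (u ++ s₁)) (Mw (u ++ s₂))) (det-common-prefix u s₁ s₂)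

gapᵃᵇ gapᵇᵃ : Mat2 → Mat2 → ℕ
gapᵃᵇ N K = e11 N * e12 K + e21 N * (3 * e12 K + e22 K)
gapᵇᵃ N K = e11 N * (e12 K + 3 * e22 K) + e21 N * e22 K

det-ab : ∀ N K → det⁻ (A ⊗ N) (B ⊗ K) ≡ det⁺ (A ⊗ N) (B ⊗ K) + gapᵃᵇ N K
det-ab (mat n₁ _ n₃ _) (mat _ k₂ _ k₄) = unfolded n₁ n₃ k₂ k₄
  where
  unfolded : ∀ n₁ n₃ k₂ k₄ → (1 * n₁ + 2 * n₃) * (2 * k₂ + 1 * k₄)
    ≡ (1 * n₁ + 1 * n₃) * (1 * k₂ + 1 * k₄) + (n₁ * k₂ + n₃ * (3 * k₂ + k₄))
  unfolded = solve-∀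

det-ba : ∀ N K → det⁺ (B ⊗ N) (A ⊗ K) ≡ det⁻ (B ⊗ N) (A ⊗ K) + gapᵇᵃ N K
det-ba (mat n₁ _ n₃ _) (mat _ k₂ _ k₄) = unfolded n₁ n₃ k₂ k₄
  where
  unfolded : ∀ n₁ n₃ k₂ k₄ → (2 * n₁ + 1 * n₃) * (1 * k₂ + 2 * k₄)
    ≡ (1 * n₁ + 1 * n₃) * (1 * k₂ + 1 * k₄) + (n₁ * (k₂ + 3 * k₄) + n₃ * k₄)
  unfolded = solve-∀

det-I₂ˡ : ∀ K → det⁺ I₂ K ≡ det⁻ I₂ K + e22 K
det-I₂ˡ K = *-identityˡ (e22 K)

det-I₂ʳ : ∀ N → det⁺ N I₂ ≡ det⁻ N I₂ + e11 N
det-I₂ʳ N = trans (*-identityʳ (e11 N)) (cong (_+ e11 N) (sym (*-zeroʳ (e21 N))))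

-- X − Y = c · (0 −1 ; 1 0)
SkewDifference : ℕ → Mat2 → Mat2 → Set
SkewDifference c X Y =
  (e11 X ≡ e11 Y) × (e12 X + c ≡ e12 Y) × (e21 X ≡ e21 Y + c) × (e22 X ≡ e22 Y)

skew : Mat2 → ℕ
skew Z = e11 Z + 3 * e21 Z + e22 Z

AZB-BZᵀA : ∀ Z → SkewDifference (skew Z) (A ⊗ (Z ⊗ B)) (B ⊗ (Z ᵀ ⊗ A))
AZB-BZᵀA (mat z₁ z₂ z₃ z₄) =
  entry₁₁ z₁ z₂ z₃ z₄ , entry₁₂ z₁ z₂ z₃ z₄ , entry₂₁ z₁ z₂ z₃ z₄ , entry₂₂ z₁ z₂ z₃ z₄
  where
  entry₁₁ : ∀ z₁ z₂ z₃ z₄ →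
    1 * (z₁ * 2 + z₂ * 1) + 1 * (z₃ * 2 + z₄ * 1) ≡ 2 * (z₁ * 1 + z₃ * 1) + 1 * (z₂ * 1 + z₄ * 1)
  entry₁₁ = solve-∀
  entry₁₂ : ∀ z₁ z₂ z₃ z₄ → 1 * (z₁ * 1 + z₂ * 1) + 1 * (z₃ * 1 + z₄ * 1) + (z₁ + 3 * z₃ + z₄)
    ≡ 2 * (z₁ * 1 + z₃ * 2) + 1 * (z₂ * 1 + z₄ * 2)
  entry₁₂ = solve-∀
  entry₂₁ : ∀ z₁ z₂ z₃ z₄ → 1 * (z₁ * 2 + z₂ * 1) + 2 * (z₃ * 2 + z₄ * 1)
    ≡ 1 * (z₁ * 1 + z₃ * 1) + 1 * (z₂ * 1 + z₄ * 1) + (z₁ + 3 * z₃ + z₄)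
  entry₂₁ = solve-∀
  entry₂₂ : ∀ z₁ z₂ z₃ z₄ →
    1 * (z₁ * 1 + z₂ * 1) + 2 * (z₃ * 1 + z₄ * 1) ≡ 1 * (z₁ * 1 + z₃ * 2) + 1 * (z₂ * 1 + z₄ * 2)
  entry₂₂ = solve-∀

-- (Nᵀ X K)₁₂ = nᵀ X k for n the first column of N and k the second column of K,
-- and nᵀ (0 −1 ; 1 0) k = det⁻ N K − det⁺ N K.
sandwich-skew : ∀ {c X Y} N K → SkewDifference c X Y →
  e12 (N ᵀ ⊗ (X ⊗ K)) ⊖ e12 (N ᵀ ⊗ (Y ⊗ K)) ≋ c * det⁻ N K ⊖ c * det⁺ N K
sandwich-skew {c} {mat x₁ x₂ _ x₄} {mat _ _ y₃ _} (mat n₁ _ n₃ _) (mat _ k₂ _ k₄)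
              (refl , refl , refl , refl) =
  balanced (unfolded n₁ n₃ k₂ k₄ x₁ x₂ y₃ x₄ c)
  where
  unfolded : ∀ n₁ n₃ k₂ k₄ x₁ x₂ y₃ x₄ c →
    n₁ * (x₁ * k₂ + x₂ * k₄) + n₃ * ((y₃ + c) * k₂ + x₄ * k₄) + c * (n₁ * k₄)
      ≡ n₁ * (x₁ * k₂ + (x₂ + c) * k₄) + n₃ * (y₃ * k₂ + x₄ * k₄) + c * (n₃ * k₂)
  unfolded = solve-∀

m-sandwich : ∀ w₁ v w₂ → m (reverse w₁ ++ v ++ w₂) ≡ e12 (Mw w₁ ᵀ ⊗ (Mw v ⊗ Mw w₂))
m-sandwich w₁ v w₂ =
  cong e12 (trans (Mw-++ (reverse w₁) (v ++ w₂)) (cong₂ _⊗_ (Mw-reverse w₁) (Mw-++ v w₂)))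

m-lhsWord : ∀ z w₁ w₂ → m (lhsWord z w₁ w₂) ≡ e12 (Mw w₁ ᵀ ⊗ ((A ⊗ (Mw z ⊗ B)) ⊗ Mw w₂))
m-lhsWord z w₁ w₂ = begin
  m (reverse w₁ ++ a ∷ z ++ b ∷ w₂)
    ≡⟨ cong (λ t → m (reverse w₁ ++ a ∷ t)) (++-assoc z [ b ] w₂) ⟨
  m (reverse w₁ ++ (a ∷ z ++ [ b ]) ++ w₂)
    ≡⟨ m-sandwich w₁ (a ∷ z ++ [ b ]) w₂ ⟩
  e12 (Mw w₁ ᵀ ⊗ (Mw (a ∷ z ++ [ b ]) ⊗ Mw w₂))
    ≡⟨ cong (λ Z → e12 (Mw w₁ ᵀ ⊗ ((A ⊗ Z) ⊗ Mw w₂))) (Mw-++ z [ b ]) ⟩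
  e12 (Mw w₁ ᵀ ⊗ ((A ⊗ (Mw z ⊗ B)) ⊗ Mw w₂))
    ∎
  where open ≡-Reasoning

m-rhsWord : ∀ z w₁ w₂ → m (rhsWord z w₁ w₂) ≡ e12 (Mw w₁ ᵀ ⊗ ((B ⊗ (Mw z ᵀ ⊗ A)) ⊗ Mw w₂))
m-rhsWord z w₁ w₂ = begin
  m (reverse w₁ ++ b ∷ reverse z ++ a ∷ w₂)
    ≡⟨ cong (λ t → m (reverse w₁ ++ b ∷ t)) (++-assoc (reverse z) [ a ] w₂) ⟨
  m (reverse w₁ ++ (b ∷ reverse z ++ [ a ]) ++ w₂)
    ≡⟨ m-sandwich w₁ (b ∷ reverse z ++ [ a ]) w₂ ⟩
  e12 (Mw w₁ ᵀ ⊗ (Mw (b ∷ reverse z ++ [ a ]) ⊗ Mw w₂))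
    ≡⟨ cong (λ Z → e12 (Mw w₁ ᵀ ⊗ ((B ⊗ Z) ⊗ Mw w₂))) Mw-reverse-z++a ⟩
  e12 (Mw w₁ ᵀ ⊗ ((B ⊗ (Mw z ᵀ ⊗ A)) ⊗ Mw w₂))
    ∎
  where
  open ≡-Reasoning
  Mw-reverse-z++a : Mw (reverse z ++ [ a ]) ≡ Mw z ᵀ ⊗ A
  Mw-reverse-z++a = trans (Mw-++ (reverse z) [ a ]) (cong (_⊗ A) (Mw-reverse z))

m-lhs⊖m-rhs : ∀ z w₁ w₂ → m (lhsWord z w₁ w₂) ⊖ m (rhsWord z w₁ w₂)
  ≋ skew (Mw z) * det⁻ (Mw w₁) (Mw w₂) ⊖ skew (Mw z) * det⁺ (Mw w₁) (Mw w₂)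
m-lhs⊖m-rhs z w₁ w₂ rewrite m-lhsWord z w₁ w₂ | m-rhsWord z w₁ w₂ =
  sandwich-skew {skew (Mw z)} {A ⊗ (Mw z ⊗ B)} {B ⊗ (Mw z ᵀ ⊗ A)} (Mw w₁) (Mw w₂) (AZB-BZᵀA (Mw z))

m-lhs⊖m-rhs-suffixes : ∀ z {u s₁ s₂ w₁ w₂} → w₁ ≡ u ++ s₁ → w₂ ≡ u ++ s₂ →
  m (lhsWord z w₁ w₂) ⊖ m (rhsWord z w₁ w₂)
    ≋ skew (Mw z) * det⁻ (Mw s₁) (Mw s₂) ⊖ skew (Mw z) * det⁺ (Mw s₁) (Mw s₂)
m-lhs⊖m-rhs-suffixes z {u} {s₁} {s₂} refl refl =
  ≋-trans (m-lhs⊖m-rhs z (u ++ s₁) (u ++ s₂)) (≋-*ˡ (skew (Mw z)) (det-common-prefix u s₁ s₂))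

n≤k*n+r : ∀ n k r .{{_ : NonZero k}} → n ≤ k * n + r
n≤k*n+r n k r = ≤-trans (m≤n*m n k) (m≤m+n (k * n) r)

n≤r+k*n : ∀ n k r .{{_ : NonZero k}} → n ≤ r + k * n
n≤r+k*n n k r = ≤-trans (m≤n*m n k) (m≤n+m (k * n) r)

e11-Mw-pos : ∀ w → 0 < e11 (Mw w)
e11-Mw-pos []      = ≤-refl
e11-Mw-pos (a ∷ w) = ≤-trans (e11-Mw-pos w) (n≤k*n+r _ 1 _)
e11-Mw-pos (b ∷ w) = ≤-trans (e11-Mw-pos w) (n≤k*n+r _ 2 _)

e22-Mw-pos : ∀ w → 0 < e22 (Mw w)
e22-Mw-pos []      = ≤-refl
e22-Mw-pos (a ∷ w) = ≤-trans (e22-Mw-pos w) (n≤r+k*n _ 2 (1 * e12 (Mw w)))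
e22-Mw-pos (b ∷ w) = ≤-trans (e22-Mw-pos w) (n≤r+k*n _ 1 (1 * e12 (Mw w)))

e21-Mw-∷-pos : ∀ x w → 0 < e21 (Mw (x ∷ w))
e21-Mw-∷-pos a w = ≤-trans (e11-Mw-pos w) (n≤k*n+r _ 1 _)
e21-Mw-∷-pos b w = ≤-trans (e11-Mw-pos w) (n≤k*n+r _ 1 _)

e12-Mw-∷-pos : ∀ x w → 0 < e12 (Mw (x ∷ w))
e12-Mw-∷-pos a w = ≤-trans (e22-Mw-pos w) (n≤r+k*n _ 1 (1 * e12 (Mw w)))
e12-Mw-∷-pos b w = ≤-trans (e22-Mw-pos w) (n≤r+k*n _ 1 (2 * e12 (Mw w)))

skew-Mw-pos : ∀ z → 0 < skew (Mw z)
skew-Mw-pos z = ≤-trans (e11-Mw-pos z) (≤-trans (m≤m+n _ _) (m≤m+n _ _))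

gapᵇᵃ-Mw-pos : ∀ t₁ t₂ → 0 < gapᵇᵃ (Mw t₁) (Mw t₂)
gapᵇᵃ-Mw-pos t₁ t₂ =
  ≤-trans (*-mono-≤ (e11-Mw-pos t₁) (≤-trans (e22-Mw-pos t₂) (n≤r+k*n _ 3 (e12 (Mw t₂))))) (m≤m+n _ _)

gapᵃᵇ-Mw≡0⇒[] : ∀ t₁ t₂ → gapᵃᵇ (Mw t₁) (Mw t₂) ≡ 0 → t₁ ≡ [] × t₂ ≡ []
gapᵃᵇ-Mw≡0⇒[] []      []      _  = refl , refl
gapᵃᵇ-Mw≡0⇒[] t₁      (x ∷ t₂) eq = contradiction eq (n>0⇒n≢0
  (≤-trans (*-mono-≤ (e11-Mw-pos t₁) (e12-Mw-∷-pos x t₂)) (m≤m+n _ _)))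
gapᵃᵇ-Mw≡0⇒[] (x ∷ t₁) t₂      eq = contradiction eq (n>0⇒n≢0
  (≤-trans (*-mono-≤ (e21-Mw-∷-pos x t₁) (≤-trans (e22-Mw-pos t₂) (m≤n+m _ (3 * e12 (Mw t₂)))))
    (m≤n+m _ (e11 (Mw (x ∷ t₁)) * e12 (Mw t₂)))))

<-by-excess : ∀ {x y c d} → y ≡ x + c * d → 0 < c → 0 < d → x < y
<-by-excess {x} eq 0<c 0<d = subst (x <_) (sym eq) (m<m+n x (*-mono-≤ 0<c 0<d))

excess≡0 : ∀ {x c d} → x + c * d ≡ x → 0 < c → d ≡ 0
excess≡0 {x} {c} {d} eq 0<c = *-cancelˡ-≡ d 0 c {{>-nonZero 0<c}}
  (trans (+-cancelˡ-≡ x (c * d) 0 (trans eq (sym (+-identityʳ x)))) (sym (*-zeroʳ c)))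

lhs-excess-ab : ∀ z {u t₁ t₂ w₁ w₂} → w₁ ≡ u ++ a ∷ t₁ → w₂ ≡ u ++ b ∷ t₂ →
  m (lhsWord z w₁ w₂) ≡ m (rhsWord z w₁ w₂) + skew (Mw z) * gapᵃᵇ (Mw t₁) (Mw t₂)
lhs-excess-ab z {u} {t₁} {t₂} h₁ h₂ =
  ≋-gap (skew (Mw z)) (m-lhs⊖m-rhs-suffixes z {u} {a ∷ t₁} {b ∷ t₂} h₁ h₂) (det-ab (Mw t₁) (Mw t₂))

lhs<rhs-ba : ∀ z {u t₁ t₂ w₁ w₂} → w₁ ≡ u ++ b ∷ t₁ → w₂ ≡ u ++ a ∷ t₂ →
  m (lhsWord z w₁ w₂) < m (rhsWord z w₁ w₂)
lhs<rhs-ba z {u} {t₁} {t₂} h₁ h₂ =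
  <-by-excess (≋-gap (skew (Mw z)) (≋-negate (m-lhs⊖m-rhs-suffixes z {u} {b ∷ t₁} {a ∷ t₂} h₁ h₂))
                     (det-ba (Mw t₁) (Mw t₂)))
              (skew-Mw-pos z) (gapᵇᵃ-Mw-pos t₁ t₂)

lhs<rhs-Case3 : ∀ z {u s₁ s₂ w₁ w₂} → w₁ ≡ u ++ s₁ → w₂ ≡ u ++ s₂ → Case3 u w₁ w₂ →
  m (lhsWord z w₁ w₂) < m (rhsWord z w₁ w₂)
lhs<rhs-Case3 z {u} {s₂ = s₂} _ h₂ (inj₁ w₁≡u) =
  <-by-excess (≋-gap (skew (Mw z))
                (≋-negate (m-lhs⊖m-rhs-suffixes z {u} {[]} {s₂} (trans w₁≡u (sym (++-identityʳ u))) h₂))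
                     (det-I₂ˡ (Mw s₂)))
              (skew-Mw-pos z) (e22-Mw-pos s₂)
lhs<rhs-Case3 z {u} {s₁} h₁ _ (inj₂ w₂≡u) =
  <-by-excess (≋-gap (skew (Mw z))
                (≋-negate (m-lhs⊖m-rhs-suffixes z {u} {s₁} {[]} h₁ (trans w₂≡u (sym (++-identityʳ u)))))
                     (det-I₂ʳ (Mw s₁)))
              (skew-Mw-pos z) (e11-Mw-pos s₁)

lhs≡rhs-Case1 : ∀ z {u t₁ t₂ w₁ w₂} → w₁ ≡ u ++ a ∷ t₁ → w₂ ≡ u ++ b ∷ t₂ →
  m (lhsWord z w₁ w₂) ≡ m (rhsWord z w₁ w₂) → w₁ ≡ u ++ [ a ] × w₂ ≡ u ++ [ b ]
lhs≡rhs-Case1 z {t₁ = t₁} {t₂} h₁ h₂ eq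
  with gapᵃᵇ-Mw≡0⇒[] t₁ t₂ (excess≡0 (trans (sym (lhs-excess-ab z h₁ h₂)) eq) (skew-Mw-pos z))
... | refl , refl = h₁ , h₂

lhs≡rhs-ab : ∀ z {u w₁ w₂} → w₁ ≡ u ++ [ a ] → w₂ ≡ u ++ [ b ] →
  m (lhsWord z w₁ w₂) ≡ m (rhsWord z w₁ w₂)
lhs≡rhs-ab z {w₁ = w₁} {w₂} h₁ h₂ =
  trans (lhs-excess-ab z h₁ h₂) (trans (cong (m (rhsWord z w₁ w₂) +_) (*-zeroʳ (skew (Mw z)))) (+-identityʳ _))

u++x∷t≢u : ∀ {u : Word} {x t} → u ++ x ∷ t ≢ u
u++x∷t≢u {u} eq with () ← ++-identityʳ-unique u (sym eq)

¬Case1×Case2 : ∀ {u w₁ w₂} → ¬ (Case1 u w₁ w₂ × Case2 u w₁ w₂)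
¬Case1×Case2 {u} ((_ , _ , h₁ , _) , (_ , _ , g₁ , _))
  with () ← ∷-injectiveˡ (++-cancelˡ u _ _ (trans (sym h₁) g₁))

extensions-¬Case3 : ∀ {u w₁ w₂ x y t₁ t₂} → w₁ ≡ u ++ x ∷ t₁ → w₂ ≡ u ++ y ∷ t₂ → ¬ Case3 u w₁ w₂
extensions-¬Case3 h₁ _ (inj₁ w₁≡u) = u++x∷t≢u (trans (sym h₁) w₁≡u)
extensions-¬Case3 _ h₂ (inj₂ w₂≡u) = u++x∷t≢u (trans (sym h₂) w₂≡u)

lcp-trichotomy : ∀ {u w₁ w₂} → IsLCP u w₁ w₂ → Case1 u w₁ w₂ ⊎ Case2 u w₁ w₂ ⊎ Case3 u w₁ w₂
lcp-trichotomy {u} {w₁} {w₂} ((s₁ , h₁) , (s₂ , h₂) , longest) = by-suffixes s₁ s₂ h₁ h₂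
  where
  common-letter-impossible : ∀ {C : Set} x {t₁ t₂} → w₁ ≡ u ++ x ∷ t₁ → w₂ ≡ u ++ x ∷ t₂ → C
  common-letter-impossible x {t₁} {t₂} g₁ g₂ = contradiction
    (longest (u ++ [ x ]) (t₁ , trans g₁ (sym (++-assoc u [ x ] t₁)))
                          (t₂ , trans g₂ (sym (++-assoc u [ x ] t₂))))
    (<⇒≱ (subst (length u <_) (sym (length-++ u)) (m<m+n (length u) z<s)))

  by-suffixes : ∀ s₁ s₂ → w₁ ≡ u ++ s₁ → w₂ ≡ u ++ s₂ →
                Case1 u w₁ w₂ ⊎ Case2 u w₁ w₂ ⊎ Case3 u w₁ w₂
  by-suffixes []       _        g₁ _  = inj₂ (inj₂ (inj₁ (trans g₁ (++-identityʳ u))))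
  by-suffixes (_ ∷ _)  []       _  g₂ = inj₂ (inj₂ (inj₂ (trans g₂ (++-identityʳ u))))
  by-suffixes (a ∷ t₁) (b ∷ t₂) g₁ g₂ = inj₁ (t₁ , t₂ , g₁ , g₂)
  by-suffixes (b ∷ t₁) (a ∷ t₂) g₁ g₂ = inj₂ (inj₁ (t₁ , t₂ , g₁ , g₂))
  by-suffixes (a ∷ _)  (a ∷ _)  g₁ g₂ = common-letter-impossible a g₁ g₂
  by-suffixes (b ∷ _)  (b ∷ _)  g₁ g₂ = common-letter-impossible b g₁ g₂

lcp-exactly-one : ∀ {u w₁ w₂} → IsLCP u w₁ w₂ →
                  ExactlyOne (Case1 u w₁ w₂) (Case2 u w₁ w₂) (Case3 u w₁ w₂)
lcp-exactly-one lcp =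
    lcp-trichotomy lcp
  , ¬Case1×Case2
  , (λ ((_ , _ , h₁ , h₂) , c₃) → extensions-¬Case3 h₁ h₂ c₃)
  , (λ ((_ , _ , h₁ , h₂) , c₃) → extensions-¬Case3 h₁ h₂ c₃)

lemma2p10 : (z w₁ w₂ u : Word) → IsLCP u w₁ w₂ →
    ExactlyOne (Case1 u w₁ w₂) (Case2 u w₁ w₂) (Case3 u w₁ w₂)
    × (∀ u₁ u₂ → w₁ ≡ u ++ a ∷ u₁ → w₂ ≡ u ++ b ∷ u₂ →
         m (lhsWord z w₁ w₂) ≥ m (rhsWord z w₁ w₂))
    × (∀ u₁ u₂ → w₁ ≡ u ++ b ∷ u₁ → w₂ ≡ u ++ a ∷ u₂ →
         m (lhsWord z w₁ w₂) < m (rhsWord z w₁ w₂))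
    × ((w₁ ≡ u) ⊎ (w₂ ≡ u) →
         m (lhsWord z w₁ w₂) < m (rhsWord z w₁ w₂))
    × ((m (lhsWord z w₁ w₂) ≡ m (rhsWord z w₁ w₂)) ⇔
         ((w₁ ≡ u ++ a ∷ []) × (w₂ ≡ u ++ b ∷ [])))
lemma2p10 z w₁ w₂ u lcp@((s₁ , w₁≡us₁) , (s₂ , w₂≡us₂) , _) =
    lcp-exactly-one lcp
  , (λ _ _ h₁ h₂ → ≤-trans (m≤m+n _ _) (≤-reflexive (sym (lhs-excess-ab z h₁ h₂))))
  , (λ _ _ → lhs<rhs-ba z)
  , lhs<rhs-Case3 z w₁≡us₁ w₂≡us₂
  , mk⇔ lhs≡rhs⇒ (λ (h₁ , h₂) → lhs≡rhs-ab z h₁ h₂)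
  where
  lhs≡rhs⇒ : m (lhsWord z w₁ w₂) ≡ m (rhsWord z w₁ w₂) → w₁ ≡ u ++ [ a ] × w₂ ≡ u ++ [ b ]
  lhs≡rhs⇒ eq with lcp-trichotomy lcp
  ... | inj₁ (_ , _ , h₁ , h₂)        = lhs≡rhs-Case1 z h₁ h₂ eq
  ... | inj₂ (inj₁ (_ , _ , h₁ , h₂)) = contradiction eq (<⇒≢ (lhs<rhs-ba z h₁ h₂))
  ... | inj₂ (inj₂ c₃)                = contradiction eq (<⇒≢ (lhs<rhs-Case3 z w₁≡us₁ w₂≡us₂ c₃))
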